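{- For all integers $n,r\ge0$, \[ (r+1)!\, C_{n,r} = \sum_{k=0}^{r} (-1)^{k} (2n-2k+1) \binom{n+\tfrac{5}{12}}{k} \binom{n-k-\tfrac{5}{12}}{r-k}\, k!\, (r-k)!, \] where $C_{n,r}=(-1)^{r} \binom{n+\tfrac{5}{12}}{r+1} + \binom{n+\tfrac{7}{12}}{r+1}$.
   Context: Binomial coefficients with non-integer upper entry are $\binom{x}{k}=x(x-1)\cdots(x-k+1)/k!$. -}

module Defs where

open import Data.Nat as ℕ using (ℕ; zero; suc; _!)
open import Data.Nat.Properties using (_!≢0)
open import Data.Integer using (+_)
open import Data.Rational using (ℚ; _+_; _*_; _-_; -_; _/_; 0ℚ; 1ℚ)

ι : ℕ → ℚ
ι n = (+ n) / 1

fall : ℚ → ℕ → ℚ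
fall x zero    = 1ℚ
fall x (suc k) = fall x k * (x - ι k)

binom : ℚ → ℕ → ℚ
binom x k = fall x k * ((+ 1) / (k !)) {{k !≢0}}

sgn : ℕ → ℚ
sgn zero    = 1ℚ
sgn (suc k) = - sgn k

sumTo : ℕ → (ℕ → ℚ) → ℚ
sumTo zero    f = f 0
sumTo (suc r) f = sumTo r f + f (suc r)

C : ℕ → ℕ → ℚ
C n r = sgn r * binom (ι n + (+ 5) / 12) (suc r) + binom (ι n + (+ 7) / 12) (suc r)

-- Clearing the factorials turns every binomial coefficient into a falling
-- factorial (x)ₖ, and the claim becomes an instance (a = n + 5/12,
-- c = n + 7/12, so a + c = 2n + 1 and c − k − 1 = n − k − 5/12) of the
-- identity, valid for all a and c,
--   (−1)ʳ (a)ᵣ₊₁ + (c)ᵣ₊₁ = Σ_{k ≤ r} (−1)ᵏ (a + c − 2k) (a)ₖ (c − k − 1)ᵣ₋ₖ .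
-- It holds by induction on r: passing from r to r + 1 multiplies each old
-- summand by c − r − 1, as it does the left side up to the defect
-- (−1)ʳ⁺¹ (a)ᵣ₊₁ ((a − r − 1) + (c − r − 1)), which is the new summand k = r + 1.
module Submission where

open import Level using (0ℓ)
open import Data.Nat as ℕ using (ℕ; zero; suc; _!; _∸_; _≤_) renaming (_*_ to _*ℕ_; _+_ to _+ℕ_)
import Data.Nat.Properties as ℕ
open import Data.Integer as ℤ using (+_)
import Data.Integer.Properties as ℤ
open import Data.Rational using (ℚ; _+_; _*_; _-_; _/_; -_; 0ℚ; 1ℚ; toℚᵘ)
open import Data.Rational.Properties
  using (_≟_; +-*-commutativeRing; toℚᵘ-injective; toℚᵘ-fromℚᵘ; toℚᵘ-homo-+; toℚᵘ-homo-*;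
         +-assoc; neg-distrib-+; *-assoc; *-identityʳ; *-distribʳ-+)
open import Data.Rational.Unnormalised as ℚᵘ using (mkℚᵘ; *≡*) renaming (_≃_ to _≃ᵘ_)
import Data.Rational.Unnormalised.Properties as ℚᵘ
open import Relation.Binary.PropositionalEquality using (_≡_; refl; sym; trans; cong; cong₂; module ≡-Reasoning)
open import Relation.Nullary.Decidable using (dec⇒maybe)
open import Tactic.RingSolver.Core.AlmostCommutativeRing using (AlmostCommutativeRing; fromCommutativeRing)
open import Tactic.RingSolver using (solve-∀)

open import Defs

ℚ-ring : AlmostCommutativeRing 0ℓ 0ℓ
ℚ-ring = fromCommutativeRing +-*-commutativeRing (λ x → dec⇒maybe (0ℚ ≟ x))

toℚᵘ-ι : ∀ n → toℚᵘ (ι n) ≃ᵘ mkℚᵘ (+ n) 0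
toℚᵘ-ι n = toℚᵘ-fromℚᵘ (mkℚᵘ (+ n) 0)

ι-+ : ∀ m n → ι (m +ℕ n) ≡ ι m + ι n
ι-+ m n = toℚᵘ-injective (begin
  toℚᵘ (ι (m +ℕ n))                ≈⟨ toℚᵘ-ι (m +ℕ n) ⟩
  mkℚᵘ (+ (m +ℕ n)) 0              ≈⟨ *≡* (cong (ℤ._* + 1) +[m+n]≡+m*1++n*1) ⟩
  mkℚᵘ (+ m) 0 ℚᵘ.+ mkℚᵘ (+ n) 0  ≈⟨ ℚᵘ.+-cong (toℚᵘ-ι m) (toℚᵘ-ι n) ⟨
  toℚᵘ (ι m) ℚᵘ.+ toℚᵘ (ι n)      ≈⟨ toℚᵘ-homo-+ (ι m) (ι n) ⟨
  toℚᵘ (ι m + ι n)                 ∎)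
  where
  open ℚᵘ.≃-Reasoning
  +[m+n]≡+m*1++n*1 : + (m +ℕ n) ≡ + m ℤ.* + 1 ℤ.+ + n ℤ.* + 1
  +[m+n]≡+m*1++n*1 =
    trans (ℤ.pos-+ m n) (sym (cong₂ ℤ._+_ (ℤ.*-identityʳ (+ m)) (ℤ.*-identityʳ (+ n))))

ι-* : ∀ m n → ι (m *ℕ n) ≡ ι m * ι n
ι-* m n = toℚᵘ-injective (begin
  toℚᵘ (ι (m *ℕ n))                ≈⟨ toℚᵘ-ι (m *ℕ n) ⟩
  mkℚᵘ (+ (m *ℕ n)) 0              ≈⟨ *≡* (cong (ℤ._* + 1) (ℤ.pos-* m n)) ⟩
  mkℚᵘ (+ m) 0 ℚᵘ.* mkℚᵘ (+ n) 0  ≈⟨ ℚᵘ.*-cong (toℚᵘ-ι m) (toℚᵘ-ι n) ⟨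
  toℚᵘ (ι m) ℚᵘ.* toℚᵘ (ι n)      ≈⟨ toℚᵘ-homo-* (ι m) (ι n) ⟨
  toℚᵘ (ι m * ι n)                 ∎)
  where open ℚᵘ.≃-Reasoning

1/n*n≡1 : ∀ n .{{_ : ℕ.NonZero n}} → ((+ 1) / n) * ι n ≡ 1ℚ
1/n*n≡1 n@(suc n-1) = toℚᵘ-injective (begin
  toℚᵘ ((+ 1) / n * ι n)              ≈⟨ toℚᵘ-homo-* ((+ 1) / n) (ι n) ⟩
  toℚᵘ ((+ 1) / n) ℚᵘ.* toℚᵘ (ι n)   ≈⟨ ℚᵘ.*-cong (toℚᵘ-fromℚᵘ (mkℚᵘ (+ 1) n-1)) (toℚᵘ-ι n) ⟩
  mkℚᵘ (+ 1) n-1 ℚᵘ.* mkℚᵘ (+ n) 0   ≈⟨ *≡* 1*n*1≡1*n ⟩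
  ℚᵘ.1ℚᵘ                              ∎)
  where
  open ℚᵘ.≃-Reasoning
  1*n*1≡1*n : (+ 1 ℤ.* + n) ℤ.* + 1 ≡ + 1 ℤ.* + suc (n-1 *ℕ 1)
  1*n*1≡1*n = trans (ℤ.*-identityʳ _) (trans (ℤ.*-identityˡ (+ n))
    (sym (trans (ℤ.*-identityˡ _) (cong (λ m → + suc m) (ℕ.*-identityʳ n-1)))))

binom*!≡fall : ∀ x k → binom x k * ι (k !) ≡ fall x k
binom*!≡fall x k = begin
  fall x k * (+ 1 / k !) * ι (k !)    ≡⟨ *-assoc (fall x k) _ (ι (k !)) ⟩
  fall x k * (+ 1 / k ! * ι (k !))    ≡⟨ cong (λ z → fall x k * z) (1/n*n≡1 (k !)) ⟩
  fall x k * 1ℚ                       ≡⟨ *-identityʳ (fall x k) ⟩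
  fall x k                            ∎
  where
  open ≡-Reasoning
  instance
    k!≢0 : ℕ.NonZero (k !)
    k!≢0 = k ℕ.!≢0

sumTo-cong : ∀ r {f g : ℕ → ℚ} → (∀ k → k ≤ r → f k ≡ g k) → sumTo r f ≡ sumTo r g
sumTo-cong zero    f≗g = f≗g 0 ℕ.z≤n
sumTo-cong (suc r) f≗g =
  cong₂ _+_ (sumTo-cong r (λ k k≤r → f≗g k (ℕ.m≤n⇒m≤1+n k≤r))) (f≗g (suc r) ℕ.≤-refl)

*-distribʳ-sumTo : ∀ r (f : ℕ → ℚ) x → sumTo r f * x ≡ sumTo r (λ k → f k * x)
*-distribʳ-sumTo zero    f x = refl
*-distribʳ-sumTo (suc r) f x =
  trans (*-distribʳ-+ x (sumTo r f) (f (suc r))) (cong (_+ f (suc r) * x) (*-distribʳ-sumTo r f x))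

module AlternatingFalls (a c : ℚ) where

  prefactor : ℕ → ℚ
  prefactor k = sgn k * (a + c - (ι k + ι k)) * fall a k

  summand : ℕ → ℕ → ℚ
  summand r k = prefactor k * fall (c - ι (suc k)) (r ∸ k)

  summand-diagonal : ∀ r → summand r r ≡ prefactor r
  summand-diagonal r =
    trans (cong (λ m → prefactor r * fall (c - ι (suc r)) m) (ℕ.n∸n≡0 r)) (*-identityʳ (prefactor r))

  summand-suc : ∀ r k → k ≤ r → summand (suc r) k ≡ summand r k * (c - ι (suc r))
  summand-suc r k k≤r = begin
    prefactor k * fall y (suc r ∸ k)                  ≡⟨ cong (λ m → prefactor k * fall y m) (ℕ.+-∸-assoc 1 k≤r) ⟩
    prefactor k * (fall y (r ∸ k) * (y - ι (r ∸ k)))  ≡⟨ *-assoc (prefactor k) (fall y (r ∸ k)) _ ⟨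
    summand r k * (y - ι (r ∸ k))                     ≡⟨ cong (λ z → summand r k * z) y-[r-k]≡c-[r+1] ⟩
    summand r k * (c - ι (suc r))                     ∎
    where
    open ≡-Reasoning
    y : ℚ
    y = c - ι (suc k)
    y-[r-k]≡c-[r+1] : y - ι (r ∸ k) ≡ c - ι (suc r)
    y-[r-k]≡c-[r+1] = begin
      c - ι (suc k) - ι (r ∸ k)        ≡⟨ +-assoc c _ _ ⟩
      c + (- ι (suc k) - ι (r ∸ k))    ≡⟨ cong (λ z → c + z) (neg-distrib-+ (ι (suc k)) (ι (r ∸ k))) ⟨
      c - (ι (suc k) + ι (r ∸ k))      ≡⟨ cong (λ z → c - z) (ι-+ (suc k) (r ∸ k)) ⟨
      c - ι (suc (k +ℕ (r ∸ k)))       ≡⟨ cong (λ m → c - ι (suc m)) (ℕ.m+[n∸m]≡n k≤r) ⟩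
      c - ι (suc r)                    ∎

  alternating-falls : ∀ r → sgn r * fall a (suc r) + fall c (suc r) ≡ sumTo r (summand r)
  alternating-falls zero = base a c
    where
    base : ∀ a c → 1ℚ * (1ℚ * (a - 0ℚ)) + 1ℚ * (c - 0ℚ) ≡ 1ℚ * (a + c - (0ℚ + 0ℚ)) * 1ℚ * 1ℚ
    base = solve-∀ ℚ-ring
  alternating-falls (suc r) = begin
    - s * (fa * (a - x)) + fc * (c - x)
      ≡⟨ split a c s fa fc x ⟩
    (s * fa + fc) * (c - x) + - s * (a + c - (x + x)) * fa
      ≡⟨ cong₂ (λ u v → u * (c - x) + v) (alternating-falls r) (sym (summand-diagonal (suc r))) ⟩
    sumTo r (summand r) * (c - x) + summand (suc r) (suc r)
      ≡⟨ cong (_+ summand (suc r) (suc r)) (*-distribʳ-sumTo r (summand r) (c - x)) ⟩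
    sumTo r (λ k → summand r k * (c - x)) + summand (suc r) (suc r)
      ≡⟨ cong (_+ summand (suc r) (suc r)) (sumTo-cong r (summand-suc r)) ⟨
    sumTo (suc r) (summand (suc r))
      ∎
    where
    open ≡-Reasoning
    s fa fc x : ℚ
    s = sgn r
    fa = fall a (suc r)
    fc = fall c (suc r)
    x = ι (suc r)
    split : ∀ a c s fa fc x →
      - s * (fa * (a - x)) + fc * (c - x) ≡ (s * fa + fc) * (c - x) + - s * (a + c - (x + x)) * fa
    split = solve-∀ ℚ-ring

alternating-binoms : ∀ a c r →
  ι (suc r !) * (sgn r * binom a (suc r) + binom c (suc r))
    ≡ sumTo r (λ k → sgn k * (a + c - (ι k + ι k)) * binom a k * binom (c - ι (suc k)) (r ∸ k)
                     * ι (k !) * ι ((r ∸ k) !))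
alternating-binoms a c r = begin
  ι (suc r !) * (sgn r * binom a (suc r) + binom c (suc r))
    ≡⟨ distribute (ι (suc r !)) (sgn r) (binom a (suc r)) (binom c (suc r)) ⟩
  sgn r * (binom a (suc r) * ι (suc r !)) + binom c (suc r) * ι (suc r !)
    ≡⟨ cong₂ (λ u v → sgn r * u + v) (binom*!≡fall a (suc r)) (binom*!≡fall c (suc r)) ⟩
  sgn r * fall a (suc r) + fall c (suc r)
    ≡⟨ alternating-falls r ⟩
  sumTo r (summand r)
    ≡⟨ sumTo-cong r (λ k _ → binom-summand k) ⟨
  sumTo r (λ k → sgn k * (a + c - (ι k + ι k)) * binom a k * binom (c - ι (suc k)) (r ∸ k)
                 * ι (k !) * ι ((r ∸ k) !))
    ∎
  where
  open ≡-Reasoning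
  open AlternatingFalls a c
  distribute : ∀ i s u v → i * (s * u + v) ≡ s * (u * i) + v * i
  distribute = solve-∀ ℚ-ring
  regroup : ∀ s d u v i j → s * d * u * v * i * j ≡ s * d * (u * i) * (v * j)
  regroup = solve-∀ ℚ-ring
  binom-summand : ∀ k →
    sgn k * (a + c - (ι k + ι k)) * binom a k * binom (c - ι (suc k)) (r ∸ k) * ι (k !) * ι ((r ∸ k) !)
      ≡ summand r k
  binom-summand k =
    trans (regroup (sgn k) _ (binom a k) (binom (c - ι (suc k)) (r ∸ k)) (ι (k !)) (ι ((r ∸ k) !)))
          (cong₂ (λ u v → sgn k * (a + c - (ι k + ι k)) * u * v)
                 (binom*!≡fall a k) (binom*!≡fall (c - ι (suc k)) (r ∸ k)))

lemma3p3 : (n r : ℕ) →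
    ι (suc r !) * C n r
      ≡ sumTo r (λ k → sgn k * (ι (2 *ℕ n +ℕ 1) - ι (2 *ℕ k))
                        * binom (ι n + (+ 5) / 12) k
                        * binom (ι n - ι k - (+ 5) / 12) (r ∸ k)
                        * ι (k !) * ι ((r ∸ k) !))
lemma3p3 n r = begin
  ι (suc r !) * C n r
    ≡⟨ alternating-binoms a c r ⟩
  sumTo r (λ k → sgn k * (a + c - (ι k + ι k)) * binom a k * binom (c - ι (suc k)) (r ∸ k)
                 * ι (k !) * ι ((r ∸ k) !))
    ≡⟨ sumTo-cong r (λ k _ → cong₂ (λ d y → sgn k * d * binom a k * binom y (r ∸ k) * ι (k !) * ι ((r ∸ k) !))
                                   (2n+1-2k≡a+c-2k k) (n-k-p≡c-[k+1] k)) ⟨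
  sumTo r (λ k → sgn k * (ι (2 *ℕ n +ℕ 1) - ι (2 *ℕ k)) * binom a k * binom (ι n - ι k - p) (r ∸ k)
                 * ι (k !) * ι ((r ∸ k) !))
    ∎
  where
  open ≡-Reasoning
  p a c : ℚ
  p = (+ 5) / 12
  a = ι n + p
  -- 1ℚ - p normalises to 7/12, so C n r is definitionally the left side of alternating-binoms.
  c = ι n + (1ℚ - p)
  2n+1-2k≡a+c-2k : ∀ k → ι (2 *ℕ n +ℕ 1) - ι (2 *ℕ k) ≡ a + c - (ι k + ι k)
  2n+1-2k≡a+c-2k k =
    trans (cong₂ (λ u v → u - v) (trans (ι-+ (2 *ℕ n) 1) (cong (_+ 1ℚ) (ι-* 2 n))) (ι-* 2 k))
          (regroup (ι n) (ι k) p)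
    where
    regroup : ∀ x y p → (1ℚ + 1ℚ) * x + 1ℚ - (1ℚ + 1ℚ) * y ≡ x + p + (x + (1ℚ - p)) - (y + y)
    regroup = solve-∀ ℚ-ring
  n-k-p≡c-[k+1] : ∀ k → ι n - ι k - p ≡ c - ι (suc k)
  n-k-p≡c-[k+1] k = trans (regroup (ι n) (ι k) p) (cong (λ z → c - z) (sym (ι-+ 1 k)))
    where
    regroup : ∀ x y p → x - y - p ≡ x + (1ℚ - p) - (1ℚ + y)
    regroup = solve-∀ ℚ-ring
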